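{- Let $M=(S,I,R,L)$ be a finite Kripke structure, let $i,j$ be indices, and let $v$ be a Boolean assignment to the propositional variables $x_{i,\mathsf{EG}}, l_{i,j}$, $y^M_{j,s}, y^M_{i,s}$ ($s\in S$) and $y^M_{i,s,k}$ ($s\in S$, $k\in\{1,\dots,|S|+1\}$) which satisfies the propositional formula $$[x_{i,\mathsf{EG}}\wedge l_{i,j}]\rightarrow\bigwedge_{s\in S}\Big[\big[y^M_{i,s,1}\leftrightarrow y^M_{j,s}\big]\wedge\bigwedge_{1\le k\le|S|}\big[y^M_{i,s,k+1}\leftrightarrow\big(y^M_{j,s}\wedge\textstyle\bigvee_{s'\in\mathrm{post}(s)}y^M_{i,s',k}\big)\big]\wedge\big[y^M_{i,s}\leftrightarrow y^M_{i,s,|S|+1}\big]\Big]$$ and such that $v(x_{i,\mathsf{EG}})=1$ and $v(l_{i,j})=1$. Then for every state $s\in S$ and every $k\in\{1,\dots,|S|+1\}$: $v(y^M_{i,s,k})=1$ if and only if there exists a path prefix $s_0s_1\dots s_t$ of $M$ with $s_0=s$ and $t\ge k-1$ such that $v(y^M_{j,\bar s})=1$ for all $\bar s\in\{s_0,s_1,\dots,s_t\}$.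
   Context: A Kripke structure $M=(S,I,R,L)$ has a set of states $S$, initial states $I\subseteq S$, a transition relation $R\subseteq S\times S$ in which every state has a successor, and a labeling $L$; $\mathrm{post}(s)=\{s'\in S\mid (s,s')\in R\}$. A path prefix is a finite sequence of states $s_0s_1\dots s_t$ with $s_{m+1}\in\mathrm{post}(s_m)$ for all $0\le m<t$. Propositional variables take values in $\{0,1\}$ and $v$ satisfies a formula in the usual sense. -}

module Defs where

open import Data.Nat using (ℕ; zero; suc; _<_; _≤_; _∸_)
open import Data.Fin using (Fin)
open import Data.Bool using (Bool; true; false; _∧_; _∨_; not)
open import Data.List using (List; []; _∷_; map; filter; foldr; upTo)
open import Data.List using () renaming (allFin to allFinL)
open import Data.Product using (Σ; ∃; _×_; _,_)
open import Relation.Binary.PropositionalEquality using (_≡_)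
open import Relation.Nullary.Decidable using (Dec)
open import Data.Bool.Properties using (_≟_)

record Kripke (AP : Set) : Set where
  field
    size  : ℕ
    I     : Fin size → Bool
    R     : Fin size → Fin size → Bool
    total : ∀ s → ∃ λ s' → R s s' ≡ true
    L     : Fin size → AP → Bool
open Kripke public

State : ∀ {AP} → Kripke AP → Set
State M = Fin (size M)

post : ∀ {AP} (M : Kripke AP) → State M → List (State M)
post M s = filter (λ s' → R M s s' ≟ true) (allFinL (size M))

data Var (n : ℕ) : Set where
  xEG : ℕ → Var n
  l   : ℕ → ℕ → Var n
  y   : ℕ → Fin n → Var n
  yk  : ℕ → Fin n → ℕ → Var n

infixr 6 _∧f_
infixr 5 _∨f_
infixr 4 _⇒f_
infix 3 _⇔f_
data Form (V : Set) : Set where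
  var  : V → Form V
  ⊤f   : Form V
  ⊥f   : Form V
  _∧f_ : Form V → Form V → Form V
  _∨f_ : Form V → Form V → Form V
  _⇒f_ : Form V → Form V → Form V
  _⇔f_ : Form V → Form V → Form V

⋀ : ∀ {V} → List (Form V) → Form V
⋀ = foldr _∧f_ ⊤f

⋁ : ∀ {V} → List (Form V) → Form V
⋁ = foldr _∨f_ ⊥f

eval : ∀ {V} → (V → Bool) → Form V → Bool
eval v (var x)   = v x
eval v ⊤f        = true
eval v ⊥f        = false
eval v (φ ∧f ψ)  = eval v φ ∧ eval v ψ
eval v (φ ∨f ψ)  = eval v φ ∨ eval v ψ
eval v (φ ⇒f ψ)  = not (eval v φ) ∨ eval v ψ
eval v (φ ⇔f ψ)  with eval v φ | eval v ψ
... | true  | true  = true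
... | false | false = true
... | _     | _     = false

_⊨_ : ∀ {V} → (V → Bool) → Form V → Set
v ⊨ φ = eval v φ ≡ true

EGformula : ∀ {AP} (M : Kripke AP) → ℕ → ℕ → Form (Var (size M))
EGformula M i j =
  (var (xEG i) ∧f var (l i j)) ⇒f
  ⋀ (map (λ s →
        (var (yk i s 1) ⇔f var (y j s))
     ∧f ⋀ (map (λ k → var (yk i s (suc k)) ⇔f
                        (var (y j s) ∧f ⋁ (map (λ s' → var (yk i s' k)) (post M s))))
               (map suc (upTo (size M))))
     ∧f (var (y i s) ⇔f var (yk i s (suc (size M)))))
     (allFinL (size M)))

-- p : ℕ → S restricted to 0..t is a path prefix s_0 … s_t of M
IsPathPrefix : ∀ {AP} (M : Kripke AP) → ℕ → (ℕ → State M) → Set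
IsPathPrefix M t p = ∀ m → m < t → R M (p m) (p (suc m)) ≡ true

{-# OPTIONS --safe #-}
-- The conjuncts of the formula for a state s say that y_{i,s,1} is y_{j,s} and that
-- y_{i,s,k+1} holds iff y_{j,s} holds and some successor satisfies y_{i,·,k}. This is
-- exactly the recursion satisfied by "some path prefix of length k-1 from s stays
-- inside {y_j}", so induction on k identifies the two; a prefix of length k-1 exists
-- iff one of length at least k-1 does, by truncation.
module Submission where

open import Defs
open import Data.Fin using (Fin)
open import Data.Nat using (ℕ; zero; suc; _<_; _≤_; _∸_; z≤n; s≤s)
open import Data.Nat.Properties using (≤-trans; <-≤-trans; ≤-refl; n≤1+n)
open import Data.Bool using (Bool; true; false; _∧_; _∨_)
open import Data.List using ([]; _∷_; map; upTo)
open import Data.List using () renaming (allFin to allFinL)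
open import Data.List.Membership.Propositional using (_∈_; find; lose)
open import Data.List.Membership.Propositional.Properties using (∈-filter⁺; ∈-filter⁻; ∈-allFin; ∈-upTo⁺)
open import Data.List.Relation.Unary.All as All using (All; _∷_)
open import Data.List.Relation.Unary.All.Properties as All using ()
open import Data.List.Relation.Unary.Any as Any using (Any; here; there)
open import Data.List.Relation.Unary.Any.Properties as Any using ()
open import Data.Product using (∃; _×_; _,_; proj₁; proj₂)
open import Data.Sum using (_⊎_; inj₁; inj₂; [_,_]; [_,_]′)
open import Relation.Binary.PropositionalEquality using (_≡_; refl; subst)
open import Function.Base using (id)
open import Function.Bundles using (_⇔_; mk⇔; Equivalence)
open import Function.Properties.Equivalence using () renaming (trans to ⇔-trans; sym to ⇔-sym)
open import Data.Bool.Properties using (_≟_)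

open Equivalence using (to; from)

∧≡true⇔ : ∀ {x y} → x ∧ y ≡ true ⇔ (x ≡ true × y ≡ true)
∧≡true⇔ {true}  {true}  = mk⇔ (λ _ → refl , refl) (λ _ → refl)
∧≡true⇔ {true}  {false} = mk⇔ (λ ()) proj₂
∧≡true⇔ {false}         = mk⇔ (λ ()) proj₁

∨≡true⇔ : ∀ {x y} → x ∨ y ≡ true ⇔ (x ≡ true ⊎ y ≡ true)
∨≡true⇔ {true}          = mk⇔ inj₁ (λ _ → refl)
∨≡true⇔ {false} {true}  = mk⇔ inj₂ (λ _ → refl)
∨≡true⇔ {false} {false} = mk⇔ inj₁ [ id , id ]

module _ {V : Set} (v : V → Bool) where

  ⊨-∧ : ∀ φ ψ → v ⊨ (φ ∧f ψ) ⇔ (v ⊨ φ × v ⊨ ψ)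
  ⊨-∧ φ ψ = ∧≡true⇔ {eval v φ}

  ⊨-⇒ : ∀ φ ψ → v ⊨ (φ ⇒f ψ) → v ⊨ φ → v ⊨ ψ
  ⊨-⇒ φ ψ h hφ with eval v φ | eval v ψ
  ⊨-⇒ φ ψ h refl | true | true = refl

  ⊨-⇔ : ∀ φ ψ → v ⊨ (φ ⇔f ψ) → (v ⊨ φ ⇔ v ⊨ ψ)
  ⊨-⇔ φ ψ h with eval v φ | eval v ψ
  ⊨-⇔ φ ψ h | true  | true  = mk⇔ id id
  ⊨-⇔ φ ψ h | false | false = mk⇔ id id

  ⊨-⋀ : ∀ φs → v ⊨ ⋀ φs → All (v ⊨_) φs
  ⊨-⋀ []       _ = All.[]
  ⊨-⋀ (φ ∷ φs) h = let hφ , hφs = to (⊨-∧ φ (⋀ φs)) h in hφ ∷ ⊨-⋀ φs hφs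

  ⊨-⋁ : ∀ φs → v ⊨ ⋁ φs ⇔ Any (v ⊨_) φs
  ⊨-⋁ []       = mk⇔ (λ ()) (λ ())
  ⊨-⋁ (φ ∷ φs) = mk⇔
    (λ h → [ here , (λ hφs → there (to (⊨-⋁ φs) hφs)) ]′ (to (∨≡true⇔ {eval v φ}) h))
    λ { (here hφ)   → from (∨≡true⇔ {eval v φ}) (inj₁ hφ)
      ; (there hφs) → from (∨≡true⇔ {eval v φ}) (inj₂ (from (⊨-⋁ φs) hφs)) }

module _ {AP : Set} (M : Kripke AP) where

  ∈-post⇔ : ∀ {s s'} → s' ∈ post M s ⇔ R M s s' ≡ true
  ∈-post⇔ {s} = mk⇔ (λ s'∈ → proj₂ (∈-filter⁻ (λ s' → R M s s' ≟ true) {xs = allFinL (size M)} s'∈))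
                    (∈-filter⁺ (λ s' → R M s s' ≟ true) (∈-allFin _))

  PathPrefixWithin : (State M → Set) → ℕ → State M → Set
  PathPrefixWithin P t s = ∃ λ (p : ℕ → State M) →
    IsPathPrefix M t p × p 0 ≡ s × (∀ m → m ≤ t → P (p m))

  module _ {P : State M → Set} where

    pathPrefixWithin-zero⇔ : ∀ {s} → PathPrefixWithin P 0 s ⇔ P s
    pathPrefixWithin-zero⇔ {s} = mk⇔
      (λ (p , _ , p0≡s , inP) → subst P p0≡s (inP 0 z≤n))
      (λ Ps → (λ _ → s) , (λ _ ()) , refl , λ { zero _ → Ps })

    pathPrefixWithin-suc⇔ : ∀ {t s} →
      PathPrefixWithin P (suc t) s ⇔ (P s × Any (PathPrefixWithin P t) (post M s))
    pathPrefixWithin-suc⇔ {t} {s} = mk⇔ split join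
      where
      split : PathPrefixWithin P (suc t) s → P s × Any (PathPrefixWithin P t) (post M s)
      split (p , path , refl , inP) =
        inP 0 z≤n ,
        lose (from ∈-post⇔ (path 0 (s≤s z≤n)))
             ((λ m → p (suc m)) , (λ m m<t → path (suc m) (s≤s m<t)) , refl ,
              λ m m≤t → inP (suc m) (s≤s m≤t))

      join : P s × Any (PathPrefixWithin P t) (post M s) → PathPrefixWithin P (suc t) s
      join (Ps , any) with find any
      ... | s' , s'∈post , (p , path , refl , inP) = cons , path′ , refl , inP′
        where
        cons : ℕ → State M
        cons zero    = s
        cons (suc m) = p m

        path′ : IsPathPrefix M (suc t) cons
        path′ zero    _          = to ∈-post⇔ s'∈post
        path′ (suc m) (s≤s m<t) = path m m<t

        inP′ : ∀ m → m ≤ suc t → P (cons m)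
        inP′ zero    _          = Ps
        inP′ (suc m) (s≤s m≤t) = inP m m≤t

    pathPrefixWithin⇔longer : ∀ {t s} → PathPrefixWithin P t s ⇔
      (∃ λ t' → ∃ λ (p : ℕ → State M) →
        IsPathPrefix M t' p × p 0 ≡ s × t ≤ t' × (∀ m → m ≤ t' → P (p m)))
    pathPrefixWithin⇔longer {t} = mk⇔
      (λ (p , path , p0≡s , inP) → t , p , path , p0≡s , ≤-refl , inP)
      (λ (t' , p , path , p0≡s , t≤t' , inP) →
        p , (λ m m<t → path m (<-≤-trans m<t t≤t')) , p0≡s ,
        λ m m≤t → inP m (≤-trans m≤t t≤t'))

EGstep : ∀ {AP} (M : Kripke AP) → ℕ → ℕ → State M → ℕ → Form (Var (size M))
EGstep M i j s k =
  var (yk i s (suc k)) ⇔f (var (y j s) ∧f ⋁ (map (λ s' → var (yk i s' k)) (post M s)))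

EGsteps : ∀ {AP} (M : Kripke AP) → ℕ → ℕ → State M → Form (Var (size M))
EGsteps M i j s = ⋀ (map (EGstep M i j s) (map suc (upTo (size M))))

EGbase : ∀ {n} → ℕ → ℕ → Fin n → Form (Var n)
EGbase i j s = var (yk i s 1) ⇔f var (y j s)

EGlast : ∀ {n} → ℕ → Fin n → Form (Var n)
EGlast {n} i s = var (y i s) ⇔f var (yk i s (suc n))

-- EGformula M i j unfolds definitionally to
-- (x_{i,EG} ∧ l_{i,j}) ⇒ ⋀ (map (EGconstraint M i j) (allFin (size M))).
EGconstraint : ∀ {AP} (M : Kripke AP) → ℕ → ℕ → State M → Form (Var (size M))
EGconstraint M i j s = EGbase i j s ∧f EGsteps M i j s ∧f EGlast i s

module _ {AP : Set} (M : Kripke AP) (i j : ℕ) (v : Var (size M) → Bool)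
         (sat : v ⊨ EGformula M i j) (x-true : v (xEG i) ≡ true) (l-true : v (l i j) ≡ true)
         where

  EGconstraint-sat : ∀ s → v ⊨ EGconstraint M i j s
  EGconstraint-sat s = All.lookup (All.map⁻ (⊨-⋀ v constraints constraints-sat)) (∈-allFin s)
    where
    constraints = map (EGconstraint M i j) (allFinL (size M))
    constraints-sat : v ⊨ ⋀ constraints
    constraints-sat = ⊨-⇒ v (var (xEG i) ∧f var (l i j)) (⋀ constraints) sat
                        (from (⊨-∧ v (var (xEG i)) (var (l i j))) (x-true , l-true))

  yk-one⇔ : ∀ s → v (yk i s 1) ≡ true ⇔ v (y j s) ≡ true
  yk-one⇔ s = ⊨-⇔ v (var (yk i s 1)) (var (y j s))
                (proj₁ (to (⊨-∧ v (EGbase i j s) (EGsteps M i j s ∧f EGlast i s)) (EGconstraint-sat s)))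

  EGstep-sat : ∀ s {k} → k < size M → v ⊨ EGstep M i j s (suc k)
  EGstep-sat s k<n = All.lookup (All.map⁻ (All.map⁻ (⊨-⋀ v steps steps-sat))) (∈-upTo⁺ k<n)
    where
    steps = map (EGstep M i j s) (map suc (upTo (size M)))
    steps-sat : v ⊨ ⋀ steps
    steps-sat = proj₁ (to (⊨-∧ v (EGsteps M i j s) (EGlast i s))
                  (proj₂ (to (⊨-∧ v (EGbase i j s) (EGsteps M i j s ∧f EGlast i s)) (EGconstraint-sat s))))

  yk-suc⇔ : ∀ s {k} → k < size M →
    v (yk i s (suc (suc k))) ≡ true ⇔
    (v (y j s) ≡ true × Any (λ s' → v (yk i s' (suc k)) ≡ true) (post M s))
  yk-suc⇔ s {k} k<n =
    ⇔-trans (⊨-⇔ v (var (yk i s (suc (suc k)))) (var (y j s) ∧f ⋁ successors) (EGstep-sat s k<n))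
      (mk⇔ (λ h → let ys , any = to (⊨-∧ v (var (y j s)) (⋁ successors)) h in
                  ys , Any.map⁻ (to (⊨-⋁ v successors) any))
           (λ (ys , any) → from (⊨-∧ v (var (y j s)) (⋁ successors))
                             (ys , from (⊨-⋁ v successors) (Any.map⁺ any))))
    where
    successors = map (λ s' → var (yk i s' (suc k))) (post M s)

  yk⇔pathPrefixWithin : ∀ {k} → k ≤ size M → ∀ s →
    v (yk i s (suc k)) ≡ true ⇔ PathPrefixWithin M (λ s → v (y j s) ≡ true) k s
  yk⇔pathPrefixWithin {zero}  _   s = ⇔-trans (yk-one⇔ s) (⇔-sym (pathPrefixWithin-zero⇔ M))
  yk⇔pathPrefixWithin {suc k} k<n s = mk⇔
    (λ h → let ys , any = to (yk-suc⇔ s k<n) h in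
           from (pathPrefixWithin-suc⇔ M) (ys , Any.map (to (ih _)) any))
    (λ q → let ys , any = to (pathPrefixWithin-suc⇔ M) q in
           from (yk-suc⇔ s k<n) (ys , Any.map (from (ih _)) any))
    where
    ih = yk⇔pathPrefixWithin (≤-trans (n≤1+n k) k<n)

lemma2 : {AP : Set} (M : Kripke AP) (i j : ℕ) (v : Var (size M) → Bool) →
    v ⊨ EGformula M i j → v (xEG i) ≡ true → v (l i j) ≡ true →
    (s : State M) (k : ℕ) → 1 ≤ k → k ≤ suc (size M) →
    (v (yk i s k) ≡ true ⇔
      (∃ λ (t : ℕ) → ∃ λ (p : ℕ → State M) →
        IsPathPrefix M t p × p 0 ≡ s × k ∸ 1 ≤ t ×
        (∀ m → m ≤ t → v (y j (p m)) ≡ true)))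
lemma2 M i j v sat x-true l-true s (suc k) _ (s≤s k≤n) =
  ⇔-trans (yk⇔pathPrefixWithin M i j v sat x-true l-true k≤n s)
          (pathPrefixWithin⇔longer M {λ s → v (y j s) ≡ true})
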